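{- Let $\mathcal{G}$ be a component-closed graph class containing $K_2$ and let $\mathcal{H}$ be a class of graphs with $\sup_{H\in\mathcal{H}}\mathrm{tw}(H)=w<\infty$. Then $c^{\mathcal{G}}_{\mathrm u}(H)\le (w+1)\,c^{\mathcal{G}}_{\mathrm l}(H)$ for all $H\in\mathcal{H}$.
   Context: All graphs are finite and simple; $\mathrm{tw}$ denotes treewidth. A class is component-closed if every connected component of every member is a member. For graphs $G,H$, a homomorphism $\varphi\colon G\to H$ is a map $V(G)\to V(H)$ with $\varphi(u)\varphi(v)\in E(H)$ whenever $uv\in E(G)$. $\dot\cup$ denotes vertex-disjoint union. For a graph class $\mathcal{G}$ and a graph $H$, a $\mathcal{G}$-cover of $H$ is an edge-surjective homomorphism $\varphi\colon G_1\dot\cup\cdots\dot\cup G_t\to H$ with all $G_i\in\mathcal{G}$; it is called $t$-global, injective if each $\varphi|_{G_i}$ is injective, and $s$-local if $|\varphi^{ -1}(v)|\le s$ for all $v\in V(H)$. $\overline{\mathcal{G}}$ is the class of all vertex-disjoint unions of graphs in $\mathcal{G}$. $c^{\mathcal{G}}_{\mathrm u}(H)$ is the least $t$ such that $H$ has a $t$-global injective $\overline{\mathcal{G}}$-cover; $c^{\mathcal{G}}_{\mathrm l}(H)$ is the least $s$ such that $H$ has an $s$-local injective $\mathcal{G}$-cover. -}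

module Defs where

open import Data.Nat using (ℕ; zero; suc; _+_; _*_; _≤_; _<_)
open import Data.Fin using (Fin; splitAt; _≟_)
import Data.Fin as F
open import Data.Fin.Subset using (Subset; _∈_; ∣_∣)
open import Data.Bool using (Bool; true; false; if_then_else_)
open import Data.Sum using (_⊎_; inj₁; inj₂)
open import Data.Product using (Σ; Σ-syntax; ∃; ∃-syntax; _×_; _,_)
open import Data.List using (List; []; _∷_; length)
open import Data.List.Relation.Unary.All using (All)
open import Data.List.Relation.Unary.Unique.Propositional using (Unique)
open import Data.Unit using (⊤)
open import Data.Empty using (⊥)
open import Relation.Nullary using (¬_)
open import Relation.Nullary.Decidable using (⌊_⌋)
open import Relation.Binary.PropositionalEquality using (_≡_; refl)
open import Function.Definitions using (Injective)

record Graph : Set where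
  field
    n      : ℕ
    adj    : Fin n → Fin n → Bool
    sym    : ∀ u v → adj u v ≡ adj v u
    irrefl : ∀ v → adj v v ≡ false

open Graph public

V : Graph → Set
V G = Fin (n G)

Edge : (G : Graph) → V G → V G → Set
Edge G u v = adj G u v ≡ true

K₂ : Graph
K₂ = record
  { n = 2
  ; adj = λ u v → if ⌊ u ≟ v ⌋ then false else true
  ; sym = symK
  ; irrefl = irrK
  }
  where
  symK : ∀ (u v : Fin 2) → (if ⌊ u ≟ v ⌋ then false else true) ≡ (if ⌊ v ≟ u ⌋ then false else true)
  symK F.zero F.zero = refl
  symK F.zero (F.suc F.zero) = refl
  symK (F.suc F.zero) F.zero = refl
  symK (F.suc F.zero) (F.suc F.zero) = refl
  irrK : ∀ (v : Fin 2) → (if ⌊ v ≟ v ⌋ then false else true) ≡ false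
  irrK F.zero = refl
  irrK (F.suc F.zero) = refl

data WalkIn (G : Graph) (P : V G → Set) : V G → V G → Set where
  here : ∀ {u} → P u → WalkIn G P u u
  step : ∀ {u x v} → P u → Edge G u x → WalkIn G P x v → WalkIn G P u v

Connected : Graph → Set
Connected G = ∀ (u v : V G) → WalkIn G (λ _ → ⊤) u v

data Chain (G : Graph) : List (V G) → Set where
  nil  : Chain G []
  one  : ∀ {u} → Chain G (u ∷ [])
  cons : ∀ {u v vs} → Edge G u v → Chain G (v ∷ vs) → Chain G (u ∷ v ∷ vs)

last : ∀ {A : Set} → A → List A → A
last a [] = a
last a (b ∷ bs) = last b bs

Cycle : (G : Graph) → List (V G) → Set
Cycle G [] = ⊥
Cycle G (v₀ ∷ vs) = (2 ≤ length vs) × Unique (v₀ ∷ vs) × Chain G (v₀ ∷ vs) × Edge G (last v₀ vs) v₀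

Acyclic : Graph → Set
Acyclic G = ∀ cs → ¬ Cycle G cs

IsTree : Graph → Set
IsTree T = (0 < n T) × Connected T × Acyclic T

record TreeDecomposition (H : Graph) (w : ℕ) : Set where
  field
    T         : Graph
    isTree    : IsTree T
    bag       : V T → Subset (n H)
    vertexCov : ∀ (v : V H) → ∃[ t ] (v ∈ bag t)
    edgeCov   : ∀ (u v : V H) → Edge H u v → ∃[ t ] (u ∈ bag t × v ∈ bag t)
    coherent  : ∀ (v : V H) (t₁ t₂ : V T) → v ∈ bag t₁ → v ∈ bag t₂ →
                WalkIn T (λ t → v ∈ bag t) t₁ t₂
    width     : ∀ (t : V T) → ∣ bag t ∣ ≤ suc w   -- width ≤ w

TwAtMost : Graph → ℕ → Set
TwAtMost H w = TreeDecomposition H w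

-- C is (isomorphic to) a connected component of G: C is nonempty and connected,
-- and embeds into G as an induced subgraph whose vertex set is closed under adjacency.
ComponentOf : Graph → Graph → Set
ComponentOf C G =
  (0 < n C) × Connected C ×
  Σ[ e ∈ (V C → V G) ] (Injective _≡_ _≡_ e ×
     (∀ u v → adj C u v ≡ adj G (e u) (e v)) ×
     (∀ u x → Edge G (e u) x → ∃[ v ] (e v ≡ x)))

ComponentClosed : (Graph → Set) → Set
ComponentClosed 𝒢 = ∀ G C → 𝒢 G → ComponentOf C G → 𝒢 C

emptyGraph : Graph
emptyGraph = record { n = 0 ; adj = λ () ; sym = λ () ; irrefl = λ () }

unionAdj : (G H : Graph) → Fin (n G + n H) → Fin (n G + n H) → Bool
unionAdj G H x y with splitAt (n G) x | splitAt (n G) y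
... | inj₁ a | inj₁ b = adj G a b
... | inj₂ a | inj₂ b = adj H a b
... | inj₁ _ | inj₂ _ = false
... | inj₂ _ | inj₁ _ = false

unionSym : (G H : Graph) → ∀ x y → unionAdj G H x y ≡ unionAdj G H y x
unionSym G H x y with splitAt (n G) x | splitAt (n G) y
... | inj₁ a | inj₁ b = sym G a b
... | inj₂ a | inj₂ b = sym H a b
... | inj₁ _ | inj₂ _ = refl
... | inj₂ _ | inj₁ _ = refl

unionIrr : (G H : Graph) → ∀ x → unionAdj G H x x ≡ false
unionIrr G H x with splitAt (n G) x
... | inj₁ a = irrefl G a
... | inj₂ a = irrefl H a

_⊕_ : Graph → Graph → Graph
G ⊕ H = record
  { n = n G + n H ; adj = unionAdj G H ; sym = unionSym G H ; irrefl = unionIrr G H }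

⨆ : List Graph → Graph
⨆ [] = emptyGraph
⨆ (G ∷ Gs) = G ⊕ ⨆ Gs

Iso : Graph → Graph → Set
Iso G H = Σ[ f ∈ (V G → V H) ] Σ[ g ∈ (V H → V G) ]
  ((∀ x → g (f x) ≡ x) × (∀ y → f (g y) ≡ y) × (∀ u v → adj G u v ≡ adj H (f u) (f v)))

-- 𝒢̄ : all vertex-disjoint unions of graphs in 𝒢 (up to isomorphism)
Bar : (Graph → Set) → Graph → Set
Bar 𝒢 G = Σ[ Gs ∈ List Graph ] (All 𝒢 Gs × Iso G (⨆ Gs))

-- Covers
-- A 𝒞-cover of H: an edge-surjective homomorphism G₁ ∪̇ ⋯ ∪̇ G_t → H with all Gᵢ ∈ 𝒞,
-- written out as a family of homomorphisms φᵢ : Gᵢ → H.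

record Cover (𝒞 : Graph → Set) (H : Graph) : Set where
  field
    t     : ℕ
    part  : Fin t → Graph
    inC   : ∀ i → 𝒞 (part i)
    φ     : ∀ i → V (part i) → V H
    hom   : ∀ i (u v : V (part i)) → Edge (part i) u v → Edge H (φ i u) (φ i v)
    surj  : ∀ (x y : V H) → Edge H x y →
            Σ[ i ∈ Fin t ] Σ[ u ∈ V (part i) ] Σ[ v ∈ V (part i) ]
              (Edge (part i) u v × φ i u ≡ x × φ i v ≡ y)

open Cover public

IsInjectiveCover : ∀ {𝒞 H} → Cover 𝒞 H → Set
IsInjectiveCover C = ∀ i → Injective _≡_ _≡_ (φ C i)

sumFin : (k : ℕ) → (Fin k → ℕ) → ℕ
sumFin zero f = 0
sumFin (suc k) f = f F.zero + sumFin k (λ i → f (F.suc i))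

countFin : (k : ℕ) → (Fin k → Bool) → ℕ
countFin k p = sumFin k (λ i → if p i then 1 else 0)

preimageSize : ∀ {𝒞 H} → Cover 𝒞 H → V H → ℕ
preimageSize {H = H} C v =
  sumFin (t C) (λ i → countFin (n (part C i)) (λ u → ⌊ φ C i u ≟ v ⌋))

HasGlobalCover : (Graph → Set) → Graph → ℕ → Set
HasGlobalCover 𝒢 H k = Σ[ C ∈ Cover (Bar 𝒢) H ] (t C ≡ k × IsInjectiveCover C)

HasLocalCover : (Graph → Set) → Graph → ℕ → Set
HasLocalCover 𝒢 H s = Σ[ C ∈ Cover 𝒢 H ] (IsInjectiveCover C × (∀ v → preimageSize C v ≤ s))

IsLeast : (ℕ → Set) → ℕ → Set
IsLeast P m = P m × (∀ k → P k → m ≤ k)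

IsCu : (Graph → Set) → Graph → ℕ → Set
IsCu 𝒢 H = IsLeast (HasGlobalCover 𝒢 H)

IsCl : (Graph → Set) → Graph → ℕ → Set
IsCl 𝒢 H = IsLeast (HasLocalCover 𝒢 H)

-- Split every part of an s-local injective 𝒢-cover into its connected components; these
-- lie in 𝒢 and map injectively onto connected subgraphs of H, so the bags of a width-w
-- tree decomposition meeting the image of a component form a subtree of the rooted tree.
-- If the images of two components intersect, the subtree whose top is higher contains the
-- top of the other. Colour the components greedily by increasing depth of their top: the
-- earlier components conflicting with X all meet the top bag of X, in pairwise distinct
-- points of the cover, while over a bag of at most w + 1 vertices with at most s preimages
-- each lie at most (w + 1) s points, one of them in X. So (w + 1) s colours suffice, and
-- each colour class is a disjoint union of components with disjoint images, i.e. one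
-- injective part of a global 𝒢̄-cover.

{-# OPTIONS --safe #-}
module Submission where

open import Defs
open import Data.Nat using (ℕ; zero; suc; _+_; _*_; _∸_; _≤_; _<_; z≤n; s≤s; _<?_)
import Data.Nat.Properties as ℕ
open import Data.Fin using (Fin; splitAt; join; toℕ; _↑ˡ_; _↑ʳ_; _≟_)
import Data.Fin as F
import Data.Fin.Properties as F
open import Data.Fin.Subset using (Subset; _∈_; ∣_∣)
open import Data.Fin.Subset.Properties using (_∈?_)
open import Data.Vec using ([]; _∷_)
import Data.Vec as Vec
import Data.Vec.Properties as Vec
open import Data.Bool using (Bool; true; false; if_then_else_)
import Data.Bool as Bool
open import Data.Sum using (_⊎_; inj₁; inj₂; [_,_]′)
open import Data.Product using (Σ; Σ-syntax; ∃; ∃-syntax; _×_; _,_; proj₁; proj₂)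
import Data.Product as Product
open import Data.List using (List; []; _∷_; length; lookup)
import Data.List as List
open import Data.List.Relation.Unary.All using (All; []; _∷_)
import Data.List.Relation.Unary.All as All
import Data.List.Relation.Unary.All.Properties as All
open import Data.List.Relation.Unary.Any using (here; there)
import Data.List.Relation.Unary.Any as Any
open import Data.List.Relation.Unary.AllPairs using ([]; _∷_)
open import Data.List.Relation.Unary.Unique.Propositional using (Unique)
import Data.List.Relation.Unary.Unique.Propositional.Properties as Unique
open import Data.List.Membership.Propositional using () renaming (_∈_ to _∈ˡ_)
open import Data.List.Membership.Propositional.Properties using (∈-lookup; ∈-filter⁺; ∈-filter⁻; ∈-allFin)
open import Data.Unit using (⊤; tt)
open import Data.Empty using (⊥; ⊥-elim)
open import Relation.Nullary using (¬_; Dec; yes; no; ¬?)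
open import Relation.Nullary.Decidable using (⌊_⌋; _×-dec_; map′)
open import Relation.Binary using (tri<; tri≈; tri>)
open import Relation.Binary.PropositionalEquality as ≡
  using (_≡_; _≢_; refl; trans; cong; cong₂; subst; subst₂; module ≡-Reasoning)
open import Axiom.UniquenessOfIdentityProofs using (module Decidable⇒UIP)
open import Function using (_∘_)
open import Function.Definitions using (Injective)
open import Algebra.Properties.Semiring.Sum ℕ.+-*-semiring
  using (sum; sum-syntax; sum-cong-≗; sum-replicate-zero; ∑-comm; *-distribˡ-sum; *-distribʳ-sum)

edge-sym : ∀ G {u v} → Edge G u v → Edge G v u
edge-sym G {u} {v} e = trans (Graph.sym G v u) e

edge-irrefl : ∀ G {u} → ¬ Edge G u u
edge-irrefl G {u} e with () ← trans (≡.sym e) (irrefl G u)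

module _ {G : Graph} where

  walk-head : ∀ {P a b} → WalkIn G P a b → P a
  walk-head (here p) = p
  walk-head (step p _ _) = p

  walk-map : ∀ {P Q : V G → Set} → (∀ x → P x → Q x) → ∀ {a b} → WalkIn G P a b → WalkIn G Q a b
  walk-map f (here p) = here (f _ p)
  walk-map f (step p e w) = step (f _ p) e (walk-map f w)

  _++ʷ_ : ∀ {P a b c} → WalkIn G P a b → WalkIn G P b c → WalkIn G P a c
  here _ ++ʷ w′ = w′
  step p e w ++ʷ w′ = step p e (w ++ʷ w′)

  walk-reverse : ∀ {P a b} → WalkIn G P a b → WalkIn G P b a
  walk-reverse (here p) = here p
  walk-reverse (step p e w) = walk-reverse w ++ʷ step (walk-head w) (edge-sym G e) (here p)

  walk-within : (R : V G → Set) → (∀ {y z} → R y → Edge G y z → R z) →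
                ∀ {P b c} → R b → WalkIn G P b c → WalkIn G R b c
  walk-within R closed r (here _) = here r
  walk-within R closed r (step _ e w) = step r e (walk-within R closed (closed r e) w)

  Path : (P : V G → Set) → V G → V G → Set
  Path P a b = Σ[ rs ∈ List (V G) ]
    (Unique (a ∷ rs) × Chain G (a ∷ rs) × All P (a ∷ rs) × last a rs ≡ b)

  path-from-member : ∀ {P a b} u rs → u ∈ˡ a ∷ rs →
    Unique (a ∷ rs) → Chain G (a ∷ rs) → All P (a ∷ rs) → last a rs ≡ b → Path P u b
  path-from-member u rs (here refl) un ch al la = rs , un , ch , al , la
  path-from-member u (r ∷ rs) (there m) (_ ∷ un) (cons _ ch) (_ ∷ al) la =
    path-from-member u rs m un ch al la

  walk⇒path : ∀ {P a b} → WalkIn G P a b → Path P a b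
  walk⇒path (here p) = [] , ([] ∷ []) , one , (p ∷ []) , refl
  walk⇒path {a = u} (step {x = x} p e w) with walk⇒path w
  ... | rs , un , ch , al , la with Any.any? (u ≟_) (x ∷ rs)
  ...   | yes m = path-from-member u rs m un ch al la
  ...   | no u∉ = (x ∷ rs) , (All.¬Any⇒All¬ (x ∷ rs) u∉ ∷ un) , cons e ch , (p ∷ al) , la

lookup-injective : ∀ {A : Set} (xs : List A) → Unique xs → Injective _≡_ _≡_ (lookup xs)
lookup-injective (x ∷ xs) (_ ∷ un) {F.zero} {F.zero} eq = refl
lookup-injective (x ∷ xs) (x∉ ∷ un) {F.zero} {F.suc j} eq =
  ⊥-elim (All.All¬⇒¬Any x∉ (subst (_∈ˡ xs) (≡.sym eq) (∈-lookup j)))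
lookup-injective (x ∷ xs) (x∉ ∷ un) {F.suc i} {F.zero} eq =
  ⊥-elim (All.All¬⇒¬Any x∉ (subst (_∈ˡ xs) eq (∈-lookup i)))
lookup-injective (x ∷ xs) (_ ∷ un) {F.suc i} {F.suc j} eq = cong F.suc (lookup-injective xs un eq)

unique⇒length≤ : ∀ {k} (xs : List (Fin k)) → Unique xs → length xs ≤ k
unique⇒length≤ xs un = F.injective⇒≤ (lookup-injective xs un)

module Reachability (G : Graph) where

  Reachable : V G → V G → Set
  Reachable = WalkIn G (λ _ → ⊤)

  reachable-refl : ∀ {u} → Reachable u u
  reachable-refl = here tt

  reachable-step : ∀ {u x y} → Reachable u x → Edge G x y → Reachable u y
  reachable-step w e = w ++ʷ step tt e (here tt)

  data BoundedWalk : ℕ → V G → V G → Set where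
    stop : ∀ {k u} → BoundedWalk k u u
    step : ∀ {k u x v} → Edge G u x → BoundedWalk k x v → BoundedWalk (suc k) u v

  edge? : ∀ u v → Dec (Edge G u v)
  edge? u v = adj G u v Bool.≟ true

  bounded-walk? : ∀ k u v → Dec (BoundedWalk k u v)
  bounded-walk? k u v with u ≟ v
  ... | yes refl = yes stop
  bounded-walk? zero u v | no u≢v = no λ { stop → u≢v refl }
  bounded-walk? (suc k) u v | no u≢v with F.any? (λ x → edge? u x ×-dec bounded-walk? k x v)
  ... | yes (x , e , b) = yes (step e b)
  ... | no ∄x = no λ { stop → u≢v refl ; (step e b) → ∄x (_ , e , b) }

  bounded-walk⇒reachable : ∀ {k u v} → BoundedWalk k u v → Reachable u v
  bounded-walk⇒reachable stop = here tt
  bounded-walk⇒reachable (step e b) = step tt e (bounded-walk⇒reachable b)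

  bounded-walk-mono : ∀ {k k′ u v} → k ≤ k′ → BoundedWalk k u v → BoundedWalk k′ u v
  bounded-walk-mono _ stop = stop
  bounded-walk-mono (s≤s k≤k′) (step e b) = step e (bounded-walk-mono k≤k′ b)

  chain⇒bounded-walk : ∀ {a b} rs → Chain G (a ∷ rs) → last a rs ≡ b → BoundedWalk (length rs) a b
  chain⇒bounded-walk [] _ refl = stop
  chain⇒bounded-walk (r ∷ rs) (cons e ch) la = step e (chain⇒bounded-walk rs ch la)

  walk⇒bounded-walk : ∀ {P u v} → WalkIn G P u v → BoundedWalk (n G) u v
  walk⇒bounded-walk w with walk⇒path w
  ... | rs , un , ch , _ , la =
    bounded-walk-mono (ℕ.≤-trans (ℕ.n≤1+n _) (unique⇒length≤ _ un)) (chain⇒bounded-walk rs ch la)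

  reachable? : ∀ u v → Dec (Reachable u v)
  reachable? u v = map′ bounded-walk⇒reachable walk⇒bounded-walk (bounded-walk? (n G) u v)

isYes-complete : ∀ {A : Set} (a? : Dec A) → A → ⌊ a? ⌋ ≡ true
isYes-complete (yes _) _ = refl
isYes-complete (no ¬a) a = ⊥-elim (¬a a)

isYes-sound : ∀ {A : Set} (a? : Dec A) → ⌊ a? ⌋ ≡ true → A
isYes-sound (yes a) _ = a

indicator : Bool → ℕ
indicator b = if b then 1 else 0

count : ∀ {k} → (Fin k → Bool) → ℕ
count P = sum (λ x → indicator (P x))

enumerate : ∀ {k} (P : Fin k → Bool) → Fin (count P) → Fin k
enumerate {suc k} P i with P F.zero
enumerate {suc k} P F.zero | true = F.zero
enumerate {suc k} P (F.suc i) | true = F.suc (enumerate (λ x → P (F.suc x)) i)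
enumerate {suc k} P i | false = F.suc (enumerate (λ x → P (F.suc x)) i)

position : ∀ {k} (P : Fin k → Bool) x → P x ≡ true → Fin (count P)
position {suc k} P F.zero px with P F.zero
position {suc k} P F.zero px | true = F.zero
position {suc k} P F.zero () | false
position {suc k} P (F.suc x) px with P F.zero
... | true = F.suc (position (λ y → P (F.suc y)) x px)
... | false = position (λ y → P (F.suc y)) x px

enumerate-position : ∀ {k} (P : Fin k → Bool) x (px : P x ≡ true) → enumerate P (position P x px) ≡ x
enumerate-position {suc k} P F.zero px with P F.zero
enumerate-position {suc k} P F.zero px | true = refl
enumerate-position {suc k} P F.zero () | false
enumerate-position {suc k} P (F.suc x) px with P F.zero
... | true = cong F.suc (enumerate-position (λ y → P (F.suc y)) x px)
... | false = cong F.suc (enumerate-position (λ y → P (F.suc y)) x px)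

enumerate-true : ∀ {k} (P : Fin k → Bool) i → P (enumerate P i) ≡ true
enumerate-true {suc k} P i with P F.zero in eq
enumerate-true {suc k} P F.zero | true = eq
enumerate-true {suc k} P (F.suc i) | true = enumerate-true (λ x → P (F.suc x)) i
enumerate-true {suc k} P i | false = enumerate-true (λ x → P (F.suc x)) i

enumerate-injective : ∀ {k} (P : Fin k → Bool) → Injective _≡_ _≡_ (enumerate P)
enumerate-injective {suc k} P {i} {j} eq with P F.zero
enumerate-injective {suc k} P {F.zero} {F.zero} eq | true = refl
enumerate-injective {suc k} P {F.suc i} {F.suc j} eq | true =
  cong F.suc (enumerate-injective (λ x → P (F.suc x)) (F.suc-injective eq))
enumerate-injective {suc k} P {i} {j} eq | false =
  enumerate-injective (λ x → P (F.suc x)) (F.suc-injective eq)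

position-enumerate : ∀ {k} (P : Fin k → Bool) i → position P (enumerate P i) (enumerate-true P i) ≡ i
position-enumerate P i = enumerate-injective P (enumerate-position P _ (enumerate-true P i))

position-injective : ∀ {k} (P : Fin k → Bool) {x y} px py → position P x px ≡ position P y py → x ≡ y
position-injective P {x} {y} px py eq = begin
  x                             ≡⟨ enumerate-position P x px ⟨
  enumerate P (position P x px) ≡⟨ cong (enumerate P) eq ⟩
  enumerate P (position P y py) ≡⟨ enumerate-position P y py ⟩
  y                             ∎
  where open ≡-Reasoning

module InducedSubgraph (G : Graph) (P : V G → Bool) where

  induced : Graph
  induced = record
    { n = count P
    ; adj = λ a b → adj G (enumerate P a) (enumerate P b)
    ; sym = λ a b → Graph.sym G (enumerate P a) (enumerate P b)
    ; irrefl = λ a → irrefl G (enumerate P a)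
    }

  position-edge : ∀ {x y} px py → Edge G x y → Edge induced (position P x px) (position P y py)
  position-edge {x} {y} px py e rewrite enumerate-position P x px | enumerate-position P y py = e

  lift-walk : ∀ {x y} → WalkIn G (λ z → P z ≡ true) x y →
              ∀ px py → WalkIn induced (λ _ → ⊤) (position P x px) (position P y py)
  lift-walk (here _) px py rewrite Decidable⇒UIP.≡-irrelevant Bool._≟_ px py = here tt
  lift-walk (step _ e w) px py = step tt (position-edge px (walk-head w) e) (lift-walk w (walk-head w) py)

module _ (G : Graph) where
  open Reachability G

  inComponent : V G → V G → Bool
  inComponent r v = ⌊ reachable? r v ⌋

  component : V G → Graph
  component r = InducedSubgraph.induced G (inComponent r)

  component-embedding : (r : V G) → V (component r) → V G
  component-embedding r = enumerate (inComponent r)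

  component-reachable : ∀ r a → Reachable r (component-embedding r a)
  component-reachable r a = isYes-sound (reachable? r _) (enumerate-true (inComponent r) a)

  component-edge : ∀ r {u v} → Reachable r u → Edge G u v →
    Σ[ a ∈ V (component r) ] Σ[ b ∈ V (component r) ]
      (Edge (component r) a b × component-embedding r a ≡ u × component-embedding r b ≡ v)
  component-edge r {u} {v} r⇝u e =
    position (inComponent r) u u∈ , position (inComponent r) v v∈ , position-edge u∈ v∈ e ,
    enumerate-position (inComponent r) u u∈ , enumerate-position (inComponent r) v v∈
    where
    open InducedSubgraph G (inComponent r)
    u∈ = isYes-complete (reachable? r u) r⇝u
    v∈ = isYes-complete (reachable? r v) (reachable-step r⇝u e)

  component-isComponentOf : ∀ r → ComponentOf (component r) G
  component-isComponentOf r =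
    nonempty , connected , component-embedding r , enumerate-injective (inComponent r) , (λ _ _ → refl) , closed
    where
    open InducedSubgraph G (inComponent r)
    nonempty : 0 < n (component r)
    nonempty = ℕ.≤-<-trans z≤n
      (F.toℕ<n (position (inComponent r) r (isYes-complete (reachable? r r) reachable-refl)))
    connected : Connected (component r)
    connected a b = subst₂ (WalkIn induced (λ _ → ⊤))
      (position-enumerate (inComponent r) a) (position-enumerate (inComponent r) b)
      (lift-walk (walk-map (λ x → isYes-complete (reachable? r x)) (walk-within (Reachable r) reachable-step
         (component-reachable r a) (walk-reverse (component-reachable r a) ++ʷ component-reachable r b)))
        (enumerate-true (inComponent r) a) (enumerate-true (inComponent r) b))
    closed : ∀ u x → Edge G (component-embedding r u) x → ∃[ v ] (component-embedding r v ≡ x)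
    closed u x e = let _ , v , _ , _ , v↦x = component-edge r (component-reachable r u) e in v , v↦x

least-witness : (Q : ℕ → Set) → (∀ k → Dec (Q k)) → ∀ m → Q m → ∃ (IsLeast Q)
least-witness Q Q? zero q = 0 , q , λ _ _ → z≤n
least-witness Q Q? (suc m) q with Q? 0
... | yes q₀ = 0 , q₀ , λ _ _ → z≤n
... | no ¬q₀ with least-witness (λ k → Q (suc k)) (λ k → Q? (suc k)) m q
...   | k , qk , k-min = suc k , qk , λ { zero q₀ → ⊥-elim (¬q₀ q₀) ; (suc j) qj → s≤s (k-min j qj) }

module RootedTree (T : Graph) (root : V T) (connected : Connected T) (acyclic : Acyclic T) where
  open Reachability T

  opaque
    depth-isLeast : ∀ a → ∃ (IsLeast (λ k → BoundedWalk k a root))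
    depth-isLeast a =
      least-witness _ (λ k → bounded-walk? k a root) (n T) (walk⇒bounded-walk (connected a root))

  depth : V T → ℕ
  depth a = proj₁ (depth-isLeast a)

  depth-walk : ∀ a → BoundedWalk (depth a) a root
  depth-walk a = proj₁ (proj₂ (depth-isLeast a))

  depth-minimal : ∀ a j → BoundedWalk j a root → depth a ≤ j
  depth-minimal a = proj₂ (proj₂ (depth-isLeast a))

  depth≤n : ∀ a → depth a ≤ n T
  depth≤n a = depth-minimal a (n T) (walk⇒bounded-walk (connected a root))

  depth-root : depth root ≡ 0
  depth-root = ℕ.n≤0⇒n≡0 (depth-minimal root 0 stop)

  depth≡0⇒root : ∀ a → depth a ≡ 0 → a ≡ root
  depth≡0⇒root a eq with stop ← subst (λ k → BoundedWalk k a root) eq (depth-walk a) = refl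

  parent-exists : ∀ a → a ≢ root → ∃[ x ] (Edge T a x × suc (depth x) ≡ depth a)
  parent-exists a a≢root with depth a | depth-walk a | depth-minimal a
  ... | _ | stop | _ = ⊥-elim (a≢root refl)
  ... | suc k | step {x = x} e b | minimal =
    x , e , ℕ.≤-antisym (s≤s (depth-minimal x k b)) (minimal (suc (depth x)) (step e (depth-walk x)))

  opaque
    parent : V T → V T
    parent a with F.any? (λ x → edge? a x ×-dec (suc (depth x) ℕ.≟ depth a))
    ... | yes (x , _) = x
    ... | no _ = a

    parent-spec : ∀ a → a ≢ root → Edge T a (parent a) × suc (depth (parent a)) ≡ depth a
    parent-spec a a≢root with F.any? (λ x → edge? a x ×-dec (suc (depth x) ℕ.≟ depth a))
    ... | yes (x , spec) = spec
    ... | no ∄x = ⊥-elim (∄x (parent-exists a a≢root))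

  depth-parent< : ∀ a → a ≢ root → depth (parent a) < depth a
  depth-parent< a a≢root = ℕ.≤-reflexive (proj₂ (parent-spec a a≢root))

  AtOrAbove : V T → V T → Set
  AtOrAbove a z = z ≡ a ⊎ depth z < depth a

  walk-to-root : ∀ a → WalkIn T (AtOrAbove a) a root
  walk-to-root a = go (depth a) a refl
    where
    go : ∀ k a → depth a ≡ k → WalkIn T (AtOrAbove a) a root
    go zero a eq rewrite depth≡0⇒root a eq = here (inj₁ refl)
    go (suc k) a eq = step (inj₁ refl) (proj₁ (parent-spec a a≢root))
      (walk-map raise (go k (parent a) (ℕ.suc-injective (trans (proj₂ (parent-spec a a≢root)) eq))))
      where
      a≢root : a ≢ root
      a≢root refl = ℕ.1+n≢0 (trans (≡.sym eq) depth-root)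
      raise : ∀ z → AtOrAbove (parent a) z → AtOrAbove a z
      raise z (inj₁ refl) = inj₂ (depth-parent< a a≢root)
      raise z (inj₂ lt) = inj₂ (ℕ.<-trans lt (depth-parent< a a≢root))

  -- If parent y ≢ x, the walks from x and from parent y up to the root avoid y, so
  -- together with the edges y–x and parent y–y they close up into a cycle.
  edge⇒parent : ∀ x y → Edge T x y → depth x ≤ depth y → y ≢ root × parent y ≡ x
  edge⇒parent x y e x≤y = y≢root , parent≡x
    where
    y≢root : y ≢ root
    y≢root refl = edge-irrefl T
      (subst (λ z → Edge T z root) (depth≡0⇒root x (ℕ.n≤0⇒n≡0 (subst (depth x ≤_) depth-root x≤y))) e)
    avoid-x : ∀ z → AtOrAbove x z → z ≢ y
    avoid-x z (inj₁ refl) refl = edge-irrefl T e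
    avoid-x z (inj₂ lt) refl = ℕ.<-irrefl refl (ℕ.<-≤-trans lt x≤y)
    avoid-p : ∀ z → AtOrAbove (parent y) z → z ≢ y
    avoid-p z (inj₁ refl) eq = ℕ.<-irrefl (cong depth eq) (depth-parent< y y≢root)
    avoid-p z (inj₂ lt) refl = ℕ.<-irrefl refl (ℕ.<-trans lt (depth-parent< y y≢root))
    around : WalkIn T (λ z → z ≢ y) x (parent y)
    around = walk-map avoid-x (walk-to-root x) ++ʷ walk-reverse (walk-map avoid-p (walk-to-root (parent y)))
    parent≡x : parent y ≡ x
    parent≡x with parent y ≟ x
    ... | yes eq = eq
    ... | no ne with walk⇒path around
    ...   | [] , _ , _ , _ , la = ⊥-elim (ne (≡.sym la))
    ...   | (r ∷ rs) , un , ch , al , la = ⊥-elim (acyclic (y ∷ x ∷ r ∷ rs)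
            ( s≤s (s≤s z≤n)
            , (All.map (λ z≢y y≡z → z≢y (≡.sym y≡z)) al ∷ un)
            , cons (edge-sym T e) ch
            , subst (λ z → Edge T z y) (≡.sym la) (edge-sym T (proj₁ (parent-spec y y≢root)))))

  edge⇒parent-or-child : ∀ x y → Edge T x y → (x ≢ root × parent x ≡ y) ⊎ (y ≢ root × parent y ≡ x)
  edge⇒parent-or-child x y e with ℕ.≤-total (depth x) (depth y)
  ... | inj₁ x≤y = inj₂ (edge⇒parent x y e x≤y)
  ... | inj₂ y≤x = inj₁ (edge⇒parent y x (edge-sym T e) y≤x)

  ancestor : ℕ → V T → V T
  ancestor zero a = a
  ancestor (suc k) a = ancestor k (parent a)

  module Subtree (S : V T → Set) (top : V T) (top∈S : S top)
                 (top-highest : ∀ t → S t → depth top ≤ depth t) where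

    ClimbsToTop : V T → Set
    ClimbsToTop x = depth top ≤ depth x × ancestor (depth x ∸ depth top) x ≡ top ×
                    (∀ j → j ≤ depth x ∸ depth top → S (ancestor j x))

    top-climbs : ClimbsToTop top
    top-climbs rewrite ℕ.n∸n≡0 (depth top) = ℕ.≤-refl , refl , λ { zero _ → top∈S }

    climbs-step : ∀ {x y} → ClimbsToTop x → Edge T x y → S y → ClimbsToTop y
    climbs-step {x} {y} (top≤x , reaches , inside) e y∈S with edge⇒parent-or-child x y e
    ... | inj₁ (x≢root , refl) = top≤y , subst (λ k → ancestor k x ≡ top) gap reaches , inside′
      where
      top≤y = top-highest y y∈S
      gap : depth x ∸ depth top ≡ suc (depth y ∸ depth top)
      gap = trans (cong (_∸ depth top) (≡.sym (proj₂ (parent-spec x x≢root)))) (ℕ.+-∸-assoc 1 top≤y)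
      inside′ : ∀ j → j ≤ depth y ∸ depth top → S (ancestor j y)
      inside′ j j≤ = inside (suc j) (subst (suc j ≤_) (≡.sym gap) (s≤s j≤))
    ... | inj₂ (y≢root , refl) = top≤y , subst (λ k → ancestor k y ≡ top) (≡.sym gap) reaches , inside′
      where
      top≤y : depth top ≤ depth y
      top≤y = subst (depth top ≤_) (proj₂ (parent-spec y y≢root)) (ℕ.m≤n⇒m≤1+n top≤x)
      gap : depth y ∸ depth top ≡ suc (depth x ∸ depth top)
      gap = trans (cong (_∸ depth top) (≡.sym (proj₂ (parent-spec y y≢root)))) (ℕ.+-∸-assoc 1 top≤x)
      inside′ : ∀ j → j ≤ depth y ∸ depth top → S (ancestor j y)
      inside′ zero _ = y∈S
      inside′ (suc j) j≤ = inside j (ℕ.≤-pred (subst (suc j ≤_) gap j≤))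

    climbs-walk : ∀ {x a} → ClimbsToTop x → WalkIn T S x a → ClimbsToTop a
    climbs-walk c (here _) = c
    climbs-walk c (step _ e w) = climbs-walk (climbs-step c e (walk-head w)) w

  -- Both tops are ancestors of a common vertex a, the climb from a to the higher top c′
  -- stays in S′, and it passes through the lower top c.
  meeting-subtree-∋-lower-top : (S S′ : V T → Set) (c c′ : V T) → S c → S′ c′ →
    (∀ t → S t → depth c ≤ depth t) → (∀ t → S′ t → depth c′ ≤ depth t) →
    depth c′ ≤ depth c →
    ∀ a → WalkIn T S c a → WalkIn T S′ c′ a → S′ c
  meeting-subtree-∋-lower-top S S′ c c′ c∈S c′∈S′ c-top c′-top c′≤c a w w′ =
    subst S′ (proj₁ (proj₂ climb)) (proj₂ (proj₂ climb′) (depth a ∸ depth c) (ℕ.∸-monoʳ-≤ (depth a) c′≤c))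
    where
    module U = Subtree S c c∈S c-top
    module U′ = Subtree S′ c′ c′∈S′ c′-top
    climb = U.climbs-walk U.top-climbs w
    climb′ = U′.climbs-walk U′.top-climbs w′

sumFin≡sum : ∀ k (f : Fin k → ℕ) → sumFin k f ≡ sum f
sumFin≡sum zero f = refl
sumFin≡sum (suc k) f = cong (f F.zero +_) (sumFin≡sum k (λ i → f (F.suc i)))

sum-mono-≤ : ∀ {k} {f g : Fin k → ℕ} → (∀ i → f i ≤ g i) → sum f ≤ sum g
sum-mono-≤ {zero} f≤g = z≤n
sum-mono-≤ {suc k} f≤g = ℕ.+-mono-≤ (f≤g F.zero) (sum-mono-≤ (λ i → f≤g (F.suc i)))

sum-δ : ∀ {k} (x : Fin k) (h : Fin k → ℕ) → sum (λ v → indicator ⌊ x ≟ v ⌋ * h v) ≡ h x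
sum-δ {suc k} F.zero h = begin
  h F.zero + 0 + sum (λ v → 0 * h (F.suc v)) ≡⟨ cong (h F.zero + 0 +_) (sum-replicate-zero k) ⟩
  h F.zero + 0 + 0                            ≡⟨ ℕ.+-identityʳ _ ⟩
  h F.zero + 0                                ≡⟨ ℕ.+-identityʳ _ ⟩
  h F.zero                                    ∎
  where open ≡-Reasoning
sum-δ {suc k} (F.suc x) h =
  trans (sum-cong-≗ (λ v → cong (λ b → indicator b * h (F.suc v)) (isYes-suc v)))
        (sum-δ x (λ v → h (F.suc v)))
  where
  isYes-suc : ∀ v → ⌊ F.suc x ≟ F.suc v ⌋ ≡ ⌊ x ≟ v ⌋
  isYes-suc v with x ≟ v
  ... | yes _ = refl
  ... | no _ = refl

sum-++ : ∀ m {k} (f : Fin (m + k) → ℕ) → sum f ≡ sum (λ i → f (i ↑ˡ k)) + sum (λ j → f (m ↑ʳ j))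
sum-++ zero f = refl
sum-++ (suc m) f = trans (cong (f F.zero +_) (sum-++ m (λ i → f (F.suc i)))) (≡.sym (ℕ.+-assoc (f F.zero) _ _))

∣p∣≡count : ∀ {k} (p : Subset k) → ∣ p ∣ ≡ count (Vec.lookup p)
∣p∣≡count [] = refl
∣p∣≡count (true ∷ p) = cong suc (∣p∣≡count p)
∣p∣≡count (false ∷ p) = ∣p∣≡count p

flatten : ∀ {k} (f : Fin k → ℕ) → Σ (Fin k) (λ i → Fin (f i)) → Fin (sum f)
flatten {suc k} f (F.zero , a) = a ↑ˡ _
flatten {suc k} f (F.suc i , u) = f F.zero ↑ʳ flatten (λ i → f (F.suc i)) (i , u)

unflatten : ∀ {k} (f : Fin k → ℕ) → Fin (sum f) → Σ (Fin k) (λ i → Fin (f i))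
unflatten {suc k} f x =
  [ (λ a → F.zero , a) , (λ b → Product.map F.suc (λ u → u) (unflatten (λ i → f (F.suc i)) b)) ]′
    (splitAt (f F.zero) x)

unflatten-↑ˡ : ∀ {k} (f : Fin (suc k) → ℕ) a →
               unflatten f (a ↑ˡ sum (λ i → f (F.suc i))) ≡ (F.zero , a)
unflatten-↑ˡ {k} f a rewrite F.splitAt-↑ˡ (f F.zero) a (sum (λ i → f (F.suc i))) = refl

unflatten-↑ʳ : ∀ {k} (f : Fin (suc k) → ℕ) b →
               unflatten f (f F.zero ↑ʳ b) ≡ Product.map F.suc (λ u → u) (unflatten (λ i → f (F.suc i)) b)
unflatten-↑ʳ {k} f b rewrite F.splitAt-↑ʳ (f F.zero) (sum (λ i → f (F.suc i))) b = refl

unflatten-flatten : ∀ {k} (f : Fin k → ℕ) p → unflatten f (flatten f p) ≡ p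
unflatten-flatten {suc k} f (F.zero , a) = unflatten-↑ˡ f a
unflatten-flatten {suc k} f (F.suc i , u) =
  trans (unflatten-↑ʳ f _) (cong (Product.map F.suc (λ u → u)) (unflatten-flatten (λ i → f (F.suc i)) (i , u)))

flatten-unflatten : ∀ {k} (f : Fin k → ℕ) x → flatten f (unflatten f x) ≡ x
flatten-unflatten {suc k} f x with splitAt (f F.zero) x in eq
... | inj₁ a = trans (cong (join _ _) (≡.sym eq)) (F.join-splitAt (f F.zero) _ x)
... | inj₂ b = trans (cong (f F.zero ↑ʳ_) (flatten-unflatten (λ i → f (F.suc i)) b))
                     (trans (cong (join _ _) (≡.sym eq)) (F.join-splitAt (f F.zero) _ x))

unflatten-injective : ∀ {k} (f : Fin k → ℕ) → Injective _≡_ _≡_ (unflatten f)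
unflatten-injective f {x} {y} eq = begin
  x                         ≡⟨ flatten-unflatten f x ⟨
  flatten f (unflatten f x) ≡⟨ cong (flatten f) eq ⟩
  flatten f (unflatten f y) ≡⟨ flatten-unflatten f y ⟩
  y                         ∎
  where open ≡-Reasoning

sum-unflatten : ∀ {k} (f : Fin k → ℕ) (g : Σ (Fin k) (λ i → Fin (f i)) → ℕ) →
                sum (λ x → g (unflatten f x)) ≡ sum (λ i → sum (λ u → g (i , u)))
sum-unflatten {zero} f g = refl
sum-unflatten {suc k} f g = trans (sum-++ (f F.zero) _) (cong₂ _+_
  (sum-cong-≗ (λ a → cong g (unflatten-↑ˡ f a)))
  (trans (sum-cong-≗ (λ b → cong g (unflatten-↑ʳ f b)))
         (sum-unflatten (λ i → f (F.suc i)) (λ p → g (F.suc (proj₁ p) , proj₂ p)))))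

module UnionMap {A : Set} (g : A → Graph) (H : Graph) (m : ∀ a → V (g a) → V H) where

  union : List A → Graph
  union zs = ⨆ (List.map g zs)

  union-map : ∀ zs → V (union zs) → V H
  union-map (z ∷ zs) x = [ m z , union-map zs ]′ (splitAt (n (g z)) x)

  union-map-hom : (∀ a u v → Edge (g a) u v → Edge H (m a u) (m a v)) →
                  ∀ zs x y → Edge (union zs) x y → Edge H (union-map zs x) (union-map zs y)
  union-map-hom hom (z ∷ zs) x y e with splitAt (n (g z)) x | splitAt (n (g z)) y
  ... | inj₁ a | inj₁ b = hom z a b e
  ... | inj₂ a | inj₂ b = union-map-hom hom zs a b e

  union-map-image : ∀ zs x → Σ[ z ∈ A ] (z ∈ˡ zs × Σ[ a ∈ V (g z) ] union-map zs x ≡ m z a)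
  union-map-image (z ∷ zs) x with splitAt (n (g z)) x
  ... | inj₁ a = z , here refl , a , refl
  ... | inj₂ b with union-map-image zs b
  ...   | z′ , z′∈ , a , eq = z′ , there z′∈ , a , eq

  DisjointImages : List A → Set
  DisjointImages zs = ∀ z z′ → z ∈ˡ zs → z′ ∈ˡ zs → z ≢ z′ → ∀ a a′ → m z a ≢ m z′ a′

  union-map-disjoint : ∀ {z zs} → All (z ≢_) zs → DisjointImages (z ∷ zs) →
                       ∀ a b → m z a ≢ union-map zs b
  union-map-disjoint z∉ disj a b eq with union-map-image _ b
  ... | z′ , z′∈ , a′ , eq′ = disj _ z′ (here refl) (there z′∈)
    (λ z≡z′ → All.All¬⇒¬Any z∉ (subst (_∈ˡ _) (≡.sym z≡z′) z′∈)) a a′ (trans eq eq′)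

  union-map-injective : (∀ a → Injective _≡_ _≡_ (m a)) →
    ∀ zs → Unique zs → DisjointImages zs → Injective _≡_ _≡_ (union-map zs)
  union-map-injective inj (z ∷ zs) (z∉ ∷ un) disj {x} {y} eq
    with splitAt (n (g z)) x in ex | splitAt (n (g z)) y in ey
  ... | inj₁ a | inj₁ b =
    trans (≡.sym (F.splitAt⁻¹-↑ˡ ex)) (trans (cong (_↑ˡ _) (inj z eq)) (F.splitAt⁻¹-↑ˡ ey))
  ... | inj₂ a | inj₂ b =
    trans (≡.sym (F.splitAt⁻¹-↑ʳ ex)) (trans (cong (_ ↑ʳ_) rest) (F.splitAt⁻¹-↑ʳ ey))
    where rest = union-map-injective inj zs un (λ z z′ m m′ → disj z z′ (there m) (there m′)) eq
  ... | inj₁ a | inj₂ b = ⊥-elim (union-map-disjoint z∉ disj a b eq)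
  ... | inj₂ a | inj₁ b = ⊥-elim (union-map-disjoint z∉ disj b a (≡.sym eq))

  union-map-covers : ∀ zs z → z ∈ˡ zs → ∀ a b → Edge (g z) a b →
    Σ[ x ∈ V (union zs) ] Σ[ y ∈ V (union zs) ]
      (Edge (union zs) x y × union-map zs x ≡ m z a × union-map zs y ≡ m z b)
  union-map-covers (z ∷ zs) .z (here refl) a b e = a ↑ˡ _ , b ↑ˡ _ , edge , image a , image b
    where
    rest = n (union zs)
    image : ∀ c → union-map (z ∷ zs) (c ↑ˡ rest) ≡ m z c
    image c rewrite F.splitAt-↑ˡ (n (g z)) c rest = refl
    edge : Edge (union (z ∷ zs)) (a ↑ˡ rest) (b ↑ˡ rest)
    edge rewrite F.splitAt-↑ˡ (n (g z)) a rest | F.splitAt-↑ˡ (n (g z)) b rest = e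
  union-map-covers (z₀ ∷ zs) z (there z∈) a b e with union-map-covers zs z z∈ a b e
  ... | x , y , exy , ex , ey = n (g z₀) ↑ʳ x , n (g z₀) ↑ʳ y , edge , trans (image x) ex , trans (image y) ey
    where
    rest = n (union zs)
    image : ∀ c → union-map (z₀ ∷ zs) (n (g z₀) ↑ʳ c) ≡ union-map zs c
    image c rewrite F.splitAt-↑ʳ (n (g z₀)) rest c = refl
    edge : Edge (union (z₀ ∷ zs)) (n (g z₀) ↑ʳ x) (n (g z₀) ↑ʳ y)
    edge rewrite F.splitAt-↑ʳ (n (g z₀)) rest x | F.splitAt-↑ʳ (n (g z₀)) rest y = exy

injective-missing⇒< : ∀ {k m} (g : Fin k → Fin m) → Injective _≡_ _≡_ g →
                      (j : Fin m) → (∀ c → g c ≢ j) → k < m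
injective-missing⇒< {m = suc m} g g-inj j missing =
  s≤s (F.injective⇒≤ (λ {c} {c′} eq → g-inj (F.punchOut-injective (j≢ c) (j≢ c′) eq)))
  where
  j≢ : ∀ c → j ≢ g c
  j≢ c eq = missing c (≡.sym eq)

module GreedyColouring
  {A : Set} (search : ∀ {P : A → Set} → (∀ x → Dec (P x)) → Dec (∃ P))
  (Active : A → Set) (active? : ∀ x → Dec (Active x))
  (_#_ : A → A → Set) (_#?_ : ∀ x y → Dec (x # y)) (#-sym : ∀ {x y} → x # y → y # x)
  (rank : A → ℕ) (rank-injective : ∀ {x y} → rank x ≡ rank y → x ≡ y)
  (bound : ℕ) (rank<bound : ∀ x → rank x < bound)
  (K : ℕ)
  (few-earlier-neighbours : ∀ x → Active x → (f : Fin K → A) → Injective _≡_ _≡_ f →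
                            ¬ (∀ c → Active (f c) × rank (f c) < rank x × x # f c))
  where

  Used : (A → ℕ) → ℕ → A → ℕ → Set
  Used col k x c = Σ[ y ∈ A ] (Active y × rank y < k × x # y × col y ≡ c)

  used? : ∀ col k x c → Dec (Used col k x c)
  used? col k x c = search (λ y → active? y ×-dec (rank y <? k) ×-dec (x #? y) ×-dec (col y ℕ.≟ c))

  first-free : (A → ℕ) → ℕ → A → ℕ
  first-free col k x with F.any? {n = K} (λ c → ¬? (used? col k x (toℕ c)))
  ... | yes (c , _) = toℕ c
  ... | no _ = 0

  first-free-spec : ∀ col k x → (Σ[ c ∈ Fin K ] ¬ Used col k x (toℕ c)) →
                    first-free col k x < K × ¬ Used col k x (first-free col k x)
  first-free-spec col k x free with F.any? {n = K} (λ c → ¬? (used? col k x (toℕ c)))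
  ... | yes (c , unused) = F.toℕ<n c , unused
  ... | no none = ⊥-elim (none free)

  -- Stage k has coloured exactly the active elements of rank below k.
  colour-upto : ℕ → A → ℕ
  colour-upto zero x = 0
  colour-upto (suc k) x with active? x ×-dec (rank x ℕ.≟ k)
  ... | yes _ = first-free (colour-upto k) k x
  ... | no _ = colour-upto k x

  colour-upto-new : ∀ k x → Active x → rank x ≡ k → colour-upto (suc k) x ≡ first-free (colour-upto k) k x
  colour-upto-new k x act rx with active? x ×-dec (rank x ℕ.≟ k)
  ... | yes _ = refl
  ... | no ¬new = ⊥-elim (¬new (act , rx))

  colour-upto-old : ∀ k x → rank x < k → colour-upto (suc k) x ≡ colour-upto k x
  colour-upto-old k x rx<k with active? x ×-dec (rank x ℕ.≟ k)
  ... | yes (_ , rx≡k) = ⊥-elim (ℕ.<-irrefl rx≡k rx<k)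
  ... | no _ = refl

  -- If every colour were used by an earlier neighbour, choosing one such neighbour per
  -- colour would give K distinct earlier neighbours.
  free-colour : ∀ k x → Active x → rank x ≡ k → Σ[ c ∈ Fin K ] ¬ Used (colour-upto k) k x (toℕ c)
  free-colour k x act rx with F.any? {n = K} (λ c → ¬? (used? (colour-upto k) k x (toℕ c)))
  ... | yes free = free
  ... | no none = ⊥-elim (few-earlier-neighbours x act user user-injective user-spec)
    where
    used : ∀ c → Used (colour-upto k) k x (toℕ c)
    used c with used? (colour-upto k) k x (toℕ c)
    ... | yes u = u
    ... | no ¬u = ⊥-elim (none (c , ¬u))
    user : Fin K → A
    user c = proj₁ (used c)
    user-colour : ∀ c → colour-upto k (user c) ≡ toℕ c
    user-colour c = proj₂ (proj₂ (proj₂ (proj₂ (used c))))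
    user-injective : Injective _≡_ _≡_ user
    user-injective {c} {c′} eq =
      F.toℕ-injective (trans (≡.sym (user-colour c)) (trans (cong (colour-upto k) eq) (user-colour c′)))
    user-spec : ∀ c → Active (user c) × rank (user c) < rank x × x # user c
    user-spec c with used c
    ... | _ , act′ , r< , adj , _ = act′ , subst (_ <_) (≡.sym rx) r< , adj

  Proper : ℕ → Set
  Proper k = (∀ x → Active x → rank x < k → colour-upto k x < K) ×
             (∀ x y → Active x → Active y → rank x < k → rank y < k → x ≢ y → x # y →
              colour-upto k x ≢ colour-upto k y)

  proper : ∀ k → Proper k
  proper zero = (λ _ _ ()) , (λ _ _ _ _ ())
  proper (suc k) with proper k
  ... | bounded , distinct = bounded′ , distinct′
    where
    new : ∀ x → Active x → rank x ≡ k →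
          colour-upto (suc k) x < K × ¬ Used (colour-upto k) k x (colour-upto (suc k) x)
    new x act rx rewrite colour-upto-new k x act rx = first-free-spec (colour-upto k) k x (free-colour k x act rx)
    bounded′ : ∀ x → Active x → rank x < suc k → colour-upto (suc k) x < K
    bounded′ x act r< with ℕ.m<1+n⇒m<n∨m≡n r<
    ... | inj₂ rx = proj₁ (new x act rx)
    ... | inj₁ r<k rewrite colour-upto-old k x r<k = bounded x act r<k
    distinct′ : ∀ x y → Active x → Active y → rank x < suc k → rank y < suc k → x ≢ y → x # y →
                colour-upto (suc k) x ≢ colour-upto (suc k) y
    distinct′ x y ax ay rx< ry< x≢y x#y with ℕ.m<1+n⇒m<n∨m≡n rx< | ℕ.m<1+n⇒m<n∨m≡n ry<
    ... | inj₂ rx | inj₂ ry = ⊥-elim (x≢y (rank-injective (trans rx (≡.sym ry))))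
    ... | inj₂ rx | inj₁ ry rewrite colour-upto-old k y ry =
      λ eq → proj₂ (new x ax rx) (y , ay , ry , x#y , ≡.sym eq)
    ... | inj₁ rx | inj₂ ry rewrite colour-upto-old k x rx =
      λ eq → proj₂ (new y ay ry) (x , ax , rx , #-sym x#y , eq)
    ... | inj₁ rx | inj₁ ry rewrite colour-upto-old k x rx | colour-upto-old k y ry =
      distinct x y ax ay rx ry x≢y x#y

  colour : A → ℕ
  colour = colour-upto bound

  colour<K : ∀ x → Active x → colour x < K
  colour<K x act = proj₁ (proper bound) x act (rank<bound x)

  colour-proper : ∀ x y → Active x → Active y → x ≢ y → x # y → colour x ≢ colour y
  colour-proper x y ax ay = proj₂ (proper bound) x y ax ay (rank<bound x) (rank<bound y)

-- A piece is a connected component of a part of the cover, named by any of its points;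
-- the point of least index is its representative.
module CoverPieces {𝒞 : Graph → Set} {H : Graph} (C : Cover 𝒞 H) where

  Point : Set
  Point = Σ[ i ∈ Fin (t C) ] V (part C i)

  sizes : Fin (t C) → ℕ
  sizes i = n (part C i)

  #points : ℕ
  #points = sum sizes

  image : Point → V H
  image (i , u) = φ C i u

  index : Point → ℕ
  index p = toℕ (flatten sizes p)

  index-injective : ∀ {p q} → index p ≡ index q → p ≡ q
  index-injective {p} {q} eq = begin
    p                                   ≡⟨ unflatten-flatten sizes p ⟨
    unflatten sizes (flatten sizes p)   ≡⟨ cong (unflatten sizes) (F.toℕ-injective eq) ⟩
    unflatten sizes (flatten sizes q)   ≡⟨ unflatten-flatten sizes q ⟩
    q                                   ∎
    where open ≡-Reasoning

  search : ∀ {P : Point → Set} → (∀ p → Dec (P p)) → Dec (∃ P)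
  search {P} P? = map′ (λ (x , px) → unflatten sizes x , px)
    (λ (p , pp) → flatten sizes p , subst P (≡.sym (unflatten-flatten sizes p)) pp)
    (F.any? (λ x → P? (unflatten sizes x)))

  data SameComponent : Point → Point → Set where
    same : ∀ {i u v} → Reachability.Reachable (part C i) u v → SameComponent (i , u) (i , v)

  same? : ∀ p q → Dec (SameComponent p q)
  same? (i , u) (j , v) with i ≟ j
  ... | yes refl = map′ same (λ { (same r) → r }) (Reachability.reachable? (part C i) u v)
  ... | no i≢j = no λ { (same _) → i≢j refl }

  same-refl : ∀ {p} → SameComponent p p
  same-refl = same (here tt)

  same-sym : ∀ {p q} → SameComponent p q → SameComponent q p
  same-sym (same r) = same (walk-reverse r)

  same-trans : ∀ {p q r} → SameComponent p q → SameComponent q r → SameComponent p r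
  same-trans (same r) (same r′) = same (r ++ʷ r′)

  IsRepresentative : Point → Set
  IsRepresentative p = ¬ (Σ[ q ∈ Point ] (SameComponent p q × index q < index p))

  representative? : ∀ p → Dec (IsRepresentative p)
  representative? p = ¬? (search (λ q → same? p q ×-dec (index q <? index p)))

  representative-unique : ∀ {p q} → IsRepresentative p → IsRepresentative q → SameComponent p q → p ≡ q
  representative-unique {p} {q} rp rq p~q with ℕ.<-cmp (index p) (index q)
  ... | tri< p<q _ _ = ⊥-elim (rq (p , same-sym p~q , p<q))
  ... | tri≈ _ p≡q _ = index-injective p≡q
  ... | tri> _ _ q<p = ⊥-elim (rp (q , p~q , q<p))

  representative-exists : ∀ p → Σ[ r ∈ Point ] (IsRepresentative r × SameComponent r p)
  representative-exists p with least-witness (λ k → Σ[ q ∈ Point ] (SameComponent q p × index q ≡ k))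
    (λ k → search (λ q → same? q p ×-dec (index q ℕ.≟ k))) (index p) (p , same-refl , refl)
  ... | _ , (q , q~p , refl) , minimal = q , rep , q~p
    where
    rep : IsRepresentative q
    rep (q′ , q~q′ , q′<q) =
      ℕ.<⇒≱ q′<q (minimal (index q′) (q′ , same-trans (same-sym q~q′) q~p , refl))

  piece : Point → Graph
  piece (i , u) = component (part C i) u

  piece-embedding : (p : Point) → V (piece p) → V (part C (proj₁ p))
  piece-embedding (i , u) = component-embedding (part C i) u

  piece-map : (p : Point) → V (piece p) → V H
  piece-map p a = φ C (proj₁ p) (piece-embedding p a)

  piece-map-hom : ∀ p a b → Edge (piece p) a b → Edge H (piece-map p a) (piece-map p b)
  piece-map-hom (i , u) a b = hom C i _ _

  piece-embedding-same : ∀ p a → SameComponent p (proj₁ p , piece-embedding p a)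
  piece-embedding-same (i , u) a = same (component-reachable (part C i) u a)

  piece-covers : ∀ r {i u v} → SameComponent r (i , u) → Edge (part C i) u v →
    Σ[ a ∈ V (piece r) ] Σ[ b ∈ V (piece r) ]
      (Edge (piece r) a b × piece-map r a ≡ φ C i u × piece-map r b ≡ φ C i v)
  piece-covers (i , r) (same r⇝u) e =
    let a , b , eab , ea , eb = component-edge (part C i) r r⇝u e
    in a , b , eab , cong (φ C i) ea , cong (φ C i) eb

  Conflict : Point → Point → Set
  Conflict p q = Σ[ p′ ∈ Point ] (SameComponent p p′ ×
                 Σ[ q′ ∈ Point ] (SameComponent q q′ × image p′ ≡ image q′))

  conflict? : ∀ p q → Dec (Conflict p q)
  conflict? p q =
    search (λ p′ → same? p p′ ×-dec search (λ q′ → same? q q′ ×-dec (image p′ ≟ image q′)))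

  conflict-sym : ∀ {p q} → Conflict p q → Conflict q p
  conflict-sym (p′ , p~p′ , q′ , q~q′ , eq) = q′ , q~q′ , p′ , p~p′ , ≡.sym eq

  PointOver : Subset (n H) → Fin #points → Bool
  PointOver B x = Vec.lookup B (image (unflatten sizes x))

  preimageSize≡sum : ∀ v → preimageSize C v ≡ sum (λ i → sum (λ u → indicator ⌊ φ C i u ≟ v ⌋))
  preimageSize≡sum v = trans (sumFin≡sum (t C) _)
    (sum-cong-≗ (λ i → sumFin≡sum (sizes i) (λ u → indicator ⌊ φ C i u ≟ v ⌋)))

  count-points-over-≤ : ∀ s → (∀ v → preimageSize C v ≤ s) →
                        ∀ B → count (PointOver B) ≤ s * ∣ B ∣
  count-points-over-≤ s local B = begin
    count (PointOver B)
      ≡⟨ sum-unflatten sizes (λ p → [ image p ]) ⟩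
    ∑[ i < t C ] ∑[ u < sizes i ] [ φ C i u ]
      ≡⟨ sum-cong-≗ (λ i → sum-cong-≗ (λ u → sum-δ (φ C i u) [_])) ⟨
    ∑[ i < t C ] ∑[ u < sizes i ] ∑[ v < n H ] (δ i u v * [ v ])
      ≡⟨ sum-cong-≗ (λ i → ∑-comm (λ u v → δ i u v * [ v ])) ⟩
    ∑[ i < t C ] ∑[ v < n H ] ∑[ u < sizes i ] (δ i u v * [ v ])
      ≡⟨ ∑-comm (λ i v → ∑[ u < sizes i ] (δ i u v * [ v ])) ⟩
    ∑[ v < n H ] ∑[ i < t C ] ∑[ u < sizes i ] (δ i u v * [ v ])
      ≡⟨ sum-cong-≗ (λ v → sum-cong-≗ (λ i → *-distribʳ-sum [ v ] (λ u → δ i u v))) ⟨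
    ∑[ v < n H ] ∑[ i < t C ] (∑[ u < sizes i ] δ i u v * [ v ])
      ≡⟨ sum-cong-≗ (λ v → *-distribʳ-sum [ v ] (λ i → ∑[ u < sizes i ] δ i u v)) ⟨
    ∑[ v < n H ] (∑[ i < t C ] ∑[ u < sizes i ] δ i u v * [ v ])
      ≡⟨ sum-cong-≗ (λ v → cong (_* [ v ]) (preimageSize≡sum v)) ⟨
    ∑[ v < n H ] (preimageSize C v * [ v ])
      ≤⟨ sum-mono-≤ (λ v → ℕ.*-monoˡ-≤ [ v ] (local v)) ⟩
    ∑[ v < n H ] (s * [ v ])
      ≡⟨ *-distribˡ-sum s [_] ⟨
    s * count (Vec.lookup B)
      ≡⟨ cong (s *_) (∣p∣≡count B) ⟨
    s * ∣ B ∣ ∎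
    where
    open ℕ.≤-Reasoning
    [_] : V H → ℕ
    [ v ] = indicator (Vec.lookup B v)
    δ : ∀ i → V (part C i) → V H → ℕ
    δ i u v = indicator ⌊ φ C i u ≟ v ⌋

module _ {H : Graph} {w : ℕ} (td : TreeDecomposition H w) where
  open TreeDecomposition td

  bags-along-walk : ∀ {G} (f : V G → V H) → (∀ u v → Edge G u v → Edge H (f u) (f v)) →
    ∀ {P u u′} → WalkIn G P u u′ → ∀ τ τ′ → f u ∈ bag τ → f u′ ∈ bag τ′ →
    WalkIn T (λ τ → Σ[ x ∈ V G ] (P x × f x ∈ bag τ)) τ τ′
  bags-along-walk f hom {u = u} (here pu) τ τ′ u∈τ u∈τ′ =
    walk-map (λ _ u∈ → u , pu , u∈) (coherent (f u) τ τ′ u∈τ u∈τ′)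
  bags-along-walk f hom {u = u} (step pu e w) τ τ′ u∈τ u′∈τ′ with edgeCov _ _ (hom _ _ e)
  ... | τ″ , u∈τ″ , x∈τ″ =
    walk-map (λ _ u∈ → u , pu , u∈) (coherent (f u) τ τ″ u∈τ u∈τ″) ++ʷ
    bags-along-walk f hom w τ″ τ′ x∈τ″ u′∈τ′

module ComponentTops {𝒞 : Graph → Set} {H : Graph} {w : ℕ} (td : TreeDecomposition H w) (C : Cover 𝒞 H) where
  open TreeDecomposition td
  open CoverPieces C

  root : V T
  root = F.fromℕ< (proj₁ isTree)

  open RootedTree T root (proj₁ (proj₂ isTree)) (proj₂ (proj₂ isTree))

  Meets : Point → V T → Set
  Meets p τ = Σ[ q ∈ Point ] (SameComponent p q × image q ∈ bag τ)

  meets? : ∀ p τ → Dec (Meets p τ)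
  meets? p τ = search (λ q → same? p q ×-dec (image q ∈? bag τ))

  meets-connected : ∀ p τ τ′ → Meets p τ → Meets p τ′ → WalkIn T (Meets p) τ τ′
  meets-connected p τ τ′ (q , p~q , q∈) (q′ , p~q′ , q′∈) =
    along (same-trans (same-sym p~q) p~q′) p~q q∈ q′∈
    where
    along : ∀ {q q′} → SameComponent q q′ → SameComponent p q → image q ∈ bag τ → image q′ ∈ bag τ′ →
            WalkIn T (Meets p) τ τ′
    along (same {i} u⇝u′) p~u u∈ u′∈ =
      walk-map (λ _ (x , p~x , x∈) → (i , x) , p~x , x∈)
        (bags-along-walk td (φ C i) (hom C i)
          (walk-within (λ x → SameComponent p (i , x)) (λ p~y e → same-trans p~y (same (step tt e (here tt))))
            p~u u⇝u′)
          τ τ′ u∈ u′∈)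

  opaque
    top-isLeast : ∀ p → ∃ (IsLeast (λ k → Σ[ τ ∈ V T ] (Meets p τ × depth τ ≡ k)))
    top-isLeast p = least-witness _ (λ k → F.any? (λ τ → meets? p τ ×-dec (depth τ ℕ.≟ k)))
      (depth τ₀) (τ₀ , (p , same-refl , proj₂ (vertexCov (image p))) , refl)
      where
      τ₀ : V T
      τ₀ = proj₁ (vertexCov (image p))

  top : Point → V T
  top p = proj₁ (proj₁ (proj₂ (top-isLeast p)))

  top-meets : ∀ p → Meets p (top p)
  top-meets p = proj₁ (proj₂ (proj₁ (proj₂ (top-isLeast p))))

  top-highest : ∀ p τ → Meets p τ → depth (top p) ≤ depth τ
  top-highest p τ m = subst (_≤ depth τ) (≡.sym (proj₂ (proj₂ (proj₁ (proj₂ (top-isLeast p))))))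
    (proj₂ (proj₂ (top-isLeast p)) (depth τ) (τ , m , refl))

  conflict⇒meets-top : ∀ x r → Conflict x r → depth (top r) ≤ depth (top x) → Meets r (top x)
  conflict⇒meets-top x r (x′ , x~x′ , r′ , r~r′ , same-image) r≤x =
    meeting-subtree-∋-lower-top (Meets x) (Meets r) (top x) (top r) (top-meets x) (top-meets r)
      (top-highest x) (top-highest r) r≤x τ
      (meets-connected x (top x) τ (top-meets x) (x′ , x~x′ , x′∈))
      (meets-connected r (top r) τ (top-meets r) (r′ , r~r′ , subst (_∈ bag τ) same-image x′∈))
    where
    τ = proj₁ (vertexCov (image x′))
    x′∈ = proj₂ (vertexCov (image x′))

  depthᶠ : V T → Fin (suc (n T))
  depthᶠ τ = F.fromℕ< (s≤s (depth≤n τ))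

  -- Components are ordered by the depth of their top bag, ties broken by index.
  rank : Point → ℕ
  rank p = toℕ (F.combine (depthᶠ (top p)) (flatten sizes p))

  rank<bound : ∀ p → rank p < suc (n T) * #points
  rank<bound p = F.toℕ<n (F.combine (depthᶠ (top p)) (flatten sizes p))

  rank-injective : ∀ {p q} → rank p ≡ rank q → p ≡ q
  rank-injective {p} {q} eq = index-injective (cong (toℕ ∘ proj₂) (begin
    (depthᶠ (top p) , flatten sizes p)
      ≡⟨ F.remQuot-combine _ _ ⟨
    F.remQuot #points (F.combine (depthᶠ (top p)) (flatten sizes p))
      ≡⟨ cong (F.remQuot #points) (F.toℕ-injective eq) ⟩
    F.remQuot #points (F.combine (depthᶠ (top q)) (flatten sizes q))
      ≡⟨ F.remQuot-combine _ _ ⟩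
    (depthᶠ (top q) , flatten sizes q) ∎))
    where open ≡-Reasoning

  rank<⇒depth-top≤ : ∀ p q → rank p < rank q → depth (top p) ≤ depth (top q)
  rank<⇒depth-top≤ p q p<q with depth (top p) ℕ.≤? depth (top q)
  ... | yes ≤ = ≤
  ... | no ≰ = ⊥-elim (ℕ.<-asym p<q (F.combine-monoˡ-< _ _ deeper))
    where
    deeper : depthᶠ (top q) F.< depthᶠ (top p)
    deeper rewrite F.toℕ-fromℕ< (s≤s (depth≤n (top q))) | F.toℕ-fromℕ< (s≤s (depth≤n (top p))) =
      ℕ.≰⇒> ≰

module GlobalFromLocal
  (𝒢 : Graph → Set) (closed : ComponentClosed 𝒢) {H : Graph} {w : ℕ} (td : TreeDecomposition H w)
  {s : ℕ} (C : Cover 𝒢 H) (injective : IsInjectiveCover C) (local : ∀ v → preimageSize C v ≤ s) where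
  open TreeDecomposition td
  open CoverPieces C
  open ComponentTops td C
  open RootedTree T root (proj₁ (proj₂ isTree)) (proj₂ (proj₂ isTree))

  K : ℕ
  K = suc w * s

  count-points-in-bag≤K : ∀ τ → count (PointOver (bag τ)) ≤ K
  count-points-in-bag≤K τ = begin
    count (PointOver (bag τ)) ≤⟨ count-points-over-≤ s local (bag τ) ⟩
    s * ∣ bag τ ∣             ≤⟨ ℕ.*-monoʳ-≤ s (width τ) ⟩
    s * suc w                 ≡⟨ ℕ.*-comm s (suc w) ⟩
    K                         ∎
    where open ℕ.≤-Reasoning

  slot : ∀ τ q → image q ∈ bag τ → Fin (count (PointOver (bag τ)))
  slot τ q q∈ = position (PointOver (bag τ)) (flatten sizes q)
    (subst (λ p → Vec.lookup (bag τ) (image p) ≡ true) (≡.sym (unflatten-flatten sizes q))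
           (Vec.[]=⇒lookup q∈))

  slot-injective : ∀ τ q q′ q∈ q′∈ → slot τ q q∈ ≡ slot τ q′ q′∈ → q ≡ q′
  slot-injective τ q q′ q∈ q′∈ eq =
    index-injective (cong toℕ (position-injective (PointOver (bag τ)) _ _ eq))

  same-slot⇒same-representative : ∀ τ {y y′ q q′} q∈ q′∈ → IsRepresentative y → IsRepresentative y′ →
    SameComponent y q → SameComponent y′ q′ → slot τ q q∈ ≡ slot τ q′ q′∈ → y ≡ y′
  same-slot⇒same-representative τ {q = q} {q′} q∈ q′∈ y-rep y′-rep y~q y′~q′ eq =
    representative-unique y-rep y′-rep (same-trans y~q
      (subst (λ p → SameComponent p _) (≡.sym (slot-injective τ q q′ q∈ q′∈ eq)) (same-sym y′~q′)))

  -- Every earlier component conflicting with x meets the top bag of x, and distinct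
  -- ones meet it in distinct points, none of them in x; so there are fewer than K.
  few-earlier-conflicts : ∀ x → IsRepresentative x → (f : Fin K → Point) → Injective _≡_ _≡_ f →
    ¬ (∀ c → IsRepresentative (f c) × rank (f c) < rank x × Conflict x (f c))
  few-earlier-conflicts x x-rep f f-injective earlier =
    ℕ.<⇒≱ (injective-missing⇒< g g-injective (slot τ _ x∈) g-misses) (count-points-in-bag≤K τ)
    where
    τ = top x
    x∈ = proj₂ (proj₂ (top-meets x))
    meets : ∀ c → Meets (f c) τ
    meets c with earlier c
    ... | _ , fc<x , conflict = conflict⇒meets-top x (f c) conflict (rank<⇒depth-top≤ (f c) x fc<x)
    g : Fin K → Fin (count (PointOver (bag τ)))
    g c = slot τ _ (proj₂ (proj₂ (meets c)))
    g-injective : Injective _≡_ _≡_ g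
    g-injective {c} {c′} eq = f-injective (same-slot⇒same-representative τ
      (proj₂ (proj₂ (meets c))) (proj₂ (proj₂ (meets c′))) (proj₁ (earlier c)) (proj₁ (earlier c′))
      (proj₁ (proj₂ (meets c))) (proj₁ (proj₂ (meets c′))) eq)
    g-misses : ∀ c → g c ≢ slot τ _ x∈
    g-misses c eq = ℕ.<-irrefl (cong rank fc≡x) (proj₁ (proj₂ (earlier c)))
      where
      fc≡x : f c ≡ x
      fc≡x = same-slot⇒same-representative τ (proj₂ (proj₂ (meets c))) x∈
        (proj₁ (earlier c)) x-rep (proj₁ (proj₂ (meets c))) (proj₁ (proj₂ (top-meets x))) eq

  open GreedyColouring search IsRepresentative representative? Conflict conflict? conflict-sym
    rank rank-injective (suc (n T) * #points) rank<bound K few-earlier-conflicts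

  InClass : Fin K → Fin #points → Set
  InClass j z = IsRepresentative (unflatten sizes z) × colour (unflatten sizes z) ≡ toℕ j

  in-class? : ∀ j z → Dec (InClass j z)
  in-class? j z = representative? (unflatten sizes z) ×-dec (colour (unflatten sizes z) ℕ.≟ toℕ j)

  class : Fin K → List (Fin #points)
  class j = List.filter (in-class? j) (List.allFin #points)

  class-unique : ∀ j → Unique (class j)
  class-unique j = Unique.filter⁺ (in-class? j) (Unique.allFin⁺ #points)

  ∈class⁻ : ∀ {j z} → z ∈ˡ class j → InClass j z
  ∈class⁻ {j} z∈ = proj₂ (∈-filter⁻ (in-class? j) {xs = List.allFin #points} z∈)

  ∈class⁺ : ∀ {j z} → InClass j z → z ∈ˡ class j
  ∈class⁺ {j} {z} inClass = ∈-filter⁺ (in-class? j) (∈-allFin z) inClass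

  open UnionMap (λ z → piece (unflatten sizes z)) H (λ z → piece-map (unflatten sizes z))

  piece∈𝒢 : ∀ p → 𝒢 (piece p)
  piece∈𝒢 (i , u) = closed (part C i) (piece (i , u)) (inC C i) (component-isComponentOf (part C i) u)

  piece-map-injective : ∀ p → Injective _≡_ _≡_ (piece-map p)
  piece-map-injective (i , u) eq = enumerate-injective _ (injective i eq)

  class-disjoint : ∀ j → DisjointImages (class j)
  class-disjoint j z z′ z∈ z′∈ z≢z′ a a′ eq =
    colour-proper (unflatten sizes z) (unflatten sizes z′) (proj₁ (∈class⁻ z∈)) (proj₁ (∈class⁻ z′∈))
      (z≢z′ ∘ unflatten-injective sizes)
      (_ , piece-embedding-same (unflatten sizes z) a , _ , piece-embedding-same (unflatten sizes z′) a′ , eq)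
      (trans (proj₂ (∈class⁻ z∈)) (≡.sym (proj₂ (∈class⁻ z′∈))))

  CoveredBy : Fin K → V H → V H → Set
  CoveredBy j x y = Σ[ u ∈ V (union (class j)) ] Σ[ v ∈ V (union (class j)) ]
    (Edge (union (class j)) u v × union-map (class j) u ≡ x × union-map (class j) v ≡ y)

  member-covers : ∀ j z → z ∈ˡ class j → ∀ {i u v} → SameComponent (unflatten sizes z) (i , u) →
                  Edge (part C i) u v → CoveredBy j (φ C i u) (φ C i v)
  member-covers j z z∈ z~u e =
    let a , b , eab , ea , eb = piece-covers (unflatten sizes z) z~u e
        x , y , exy , ex , ey = union-map-covers (class j) z z∈ a b eab
    in x , y , exy , trans ex ea , trans ey eb

  colour-class : ∀ r → IsRepresentative r → Fin K
  colour-class r r-rep = F.fromℕ< (colour<K r r-rep)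

  flatten∈colour-class : ∀ r r-rep → flatten sizes r ∈ˡ class (colour-class r r-rep)
  flatten∈colour-class r r-rep = ∈class⁺
    ( subst IsRepresentative (≡.sym (unflatten-flatten sizes r)) r-rep
    , trans (cong colour (unflatten-flatten sizes r)) (≡.sym (F.toℕ-fromℕ< (colour<K r r-rep))))

  class-covers : ∀ x y → Edge H x y → ∃[ j ] CoveredBy j x y
  class-covers x y e =
    let i , u , v , e′ , ex , ey = surj C x y e
        r , r-rep , r~u = representative-exists (i , u)
    in colour-class r r-rep , subst₂ (CoveredBy (colour-class r r-rep)) ex ey
         (member-covers _ _ (flatten∈colour-class r r-rep)
           (subst (λ p → SameComponent p (i , u)) (≡.sym (unflatten-flatten sizes r)) r~u) e′)

  global-cover : HasGlobalCover 𝒢 H K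
  global-cover = record
    { t = K
    ; part = λ j → union (class j)
    ; inC = λ j → List.map (λ z → piece (unflatten sizes z)) (class j)
                , All.map⁺ (All.universal (λ z → piece∈𝒢 (unflatten sizes z)) (class j))
                , Iso-refl (union (class j))
    ; φ = λ j → union-map (class j)
    ; hom = λ j → union-map-hom (λ z → piece-map-hom (unflatten sizes z)) (class j)
    ; surj = class-covers
    } , refl , λ j → union-map-injective (λ z → piece-map-injective (unflatten sizes z))
                       (class j) (class-unique j) (class-disjoint j)
    where
    Iso-refl : ∀ G → Iso G G
    Iso-refl G = (λ x → x) , (λ x → x) , (λ _ → refl) , (λ _ → refl) , (λ _ _ → refl)

local⇒global-cover : ∀ 𝒢 → ComponentClosed 𝒢 → ∀ {H w s} →
                     TwAtMost H w → HasLocalCover 𝒢 H s → HasGlobalCover 𝒢 H (suc w * s)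
local⇒global-cover 𝒢 closed td (C , injective , local) =
  GlobalFromLocal.global-cover 𝒢 closed td C injective local

theorem6 : (𝒢 ℋ : Graph → Set) (w : ℕ) →
    ComponentClosed 𝒢 → 𝒢 K₂ →
    (∀ H → ℋ H → TwAtMost H w) →
    (∀ w′ → (∀ H → ℋ H → TwAtMost H w′) → w ≤ w′) →
    ∀ H → ℋ H → ∀ cu cl → IsCu 𝒢 H cu → IsCl 𝒢 H cl → cu ≤ suc w * cl
theorem6 𝒢 ℋ w closed _ tw _ H H∈ℋ cu cl (_ , cu-least) (local-cover , _) =
  cu-least (suc w * cl) (local⇒global-cover 𝒢 closed (tw H H∈ℋ) local-cover)
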